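{- Let $f_{\alpha}, f_{\beta}: \mathbb{N} \rightarrow \mathbb{R}_{\ge 0}$ be monotonically non-decreasing computable functions with $1 \le f_{\alpha}(1)$ and $2 \le f_{\alpha}(1) + f_{\beta}(1)$, and let $t = f_{\alpha}(1)+f_{\beta}(1)$. Let $G$ be an undirected graph with $V(G)=\{v_1,\dots,v_n\}$ and let $l$ be an integer. Construct a digraph $D$ as follows. Its vertices are a vertex $w$ and, for each $i\in[n]$, four vertices $R_l[i], R_c[i], R_r[i], B[i]$. For each $i \in [n]$ add the arcs $(w,R_l[i])$, $(w,R_c[i])$, $(w,B[i])$, $(R_l[i],R_c[i])$, $(R_c[i],R_r[i])$, $(R_r[i],B[i])$. For each edge $v_iv_j \in E(G)$ add the arcs $(R_r[i],B[j])$ and $(R_r[j],B[i])$. Finally, if $\lfloor t\rfloor = 2$, contract the arc $(R_c[i],R_r[i])$ for every $i\in[n]$; if $\lfloor t\rfloor=3$, do nothing; if $\lfloor t \rfloor \ge 4$, subdivide the arc $(R_c[i],R_r[i])$ exactly $\lfloor t-3\rfloor$ times for every $i\in[n]$. Let $k = 2n - l$. If $(D, f_{\alpha}, f_{\beta}, k)$ is a \textsc{Yes}-instance of \textsc{Directed Linear Spanner}, then $G$ has a dominating set of size at most $l$.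
   Context: A dominating set of an undirected graph $G$ is a set $X\subseteq V(G)$ such that every vertex of $G$ is in $X$ or adjacent to a vertex of $X$. For a digraph $D$, $\mathsf{dist}(u,v,D)$ is the number of arcs of a shortest directed path from $u$ to $v$ ($+\infty$ if none). Subdividing an arc $(u,v)$ $q$ times means deleting it and adding a new directed path of length $q+1$ from $u$ to $v$ through $q$ new vertices. Contracting an arc $(u,v)$ replaces $u$ and $v$ by a single new vertex $z$, where every arc of $D$ with an endpoint in $\{u,v\}$ is redirected to have $z$ in place of that endpoint (the arc $(u,v)$ itself disappears; no loops or parallel arcs are kept). \textsc{Directed Linear Spanner}: given a digraph $D$, monotonically non-decreasing computable functions $f_{\alpha}, f_{\beta}: \mathbb{N} \rightarrow \mathbb{R}_{\ge 0}$ and a positive integer $k$, decide whether there is a spanning subgraph $H$ of $D$ (i.e. $V(H)=V(D)$) with at most $|A(D)|-k$ arcs such that $\mathsf{dist}(u,v,H) \le f_{\alpha}(\mathsf{dist}(u,v,D))\cdot \mathsf{dist}(u,v,D) + f_{\beta}(\mathsf{dist}(u,v,D))$ for all vertices $u,v$.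
   Formalization: The functions $f_{\alpha}$ and $f_{\beta}$ take nonnegative rational values rather than values in $\mathbb{R}_{\ge 0}$. -}

module Defs where

open import Level using (Level; suc; zero)
open import Data.Nat as ℕ using (ℕ; _∸_)
open import Data.Integer as ℤ using (ℤ; +_)
open import Data.Rational as ℚ using (ℚ; _/_; floor)
open import Data.Bool using (Bool; true; false)
open import Data.Fin using (Fin)
open import Data.Fin.Subset using (Subset; _∈_; ∣_∣)
open import Data.List using (List; []; _∷_; _++_; map; concatMap; length; allFin)
open import Data.List.Relation.Unary.All using (All)
open import Data.List.Relation.Unary.Unique.Propositional using (Unique)
import Data.List.Membership.Propositional as LM
open import Data.Product using (_×_; _,_; Σ; ∃; ∃-syntax)
open import Data.Sum using (_⊎_)
open import Relation.Binary.PropositionalEquality using (_≡_)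
open import Relation.Nullary using (¬_)

-- Undirected (simple) graphs on vertex set {v_0,…,v_{n-1}} = Fin n,
-- given by a symmetric, irreflexive Boolean adjacency relation.

record Graph : Set where
  field
    n     : ℕ
    adj   : Fin n → Fin n → Bool
    sym   : ∀ i j → adj i j ≡ adj j i
    irrfl : ∀ i → adj i i ≡ false

open Graph public

IsDominating : (G : Graph) → Subset (n G) → Set
IsDominating G X = ∀ v → v ∈ X ⊎ (∃[ u ] (u ∈ X × adj G u v ≡ true))

record Digraph : Set₁ where
  field
    V    : Set
    arcs : List (V × V)

open Digraph public

data Walk {V : Set} (A : List (V × V)) : V → V → ℕ → Set where
  []  : ∀ {u} → Walk A u u 0
  _∷_ : ∀ {u v x d} → (u , v) LM.∈ A → Walk A v x d → Walk A u x (ℕ.suc d)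

IsDist : {V : Set} → List (V × V) → V → V → ℕ → Set
IsDist A u v d = Walk A u v d × (∀ e → e ℕ.< d → ¬ Walk A u v e)

ℕ→ℚ : ℕ → ℚ
ℕ→ℚ m = (+ m) / 1

-- A spanning subgraph H has the same vertex set; it is given by a
-- duplicate-free list of arcs of D.  The distance condition
-- dist(u,v,H) ≤ fα(d)·d + fβ(d) with d = dist(u,v,D) is imposed for all
-- u,v with d finite (if d = ∞ the bound is +∞ and imposes nothing).
DLSYes : (D : Digraph) → (ℕ → ℚ) → (ℕ → ℚ) → ℤ → Set
DLSYes D fα fβ k =
  (+ 0 ℤ.< k) ×
  Σ (List (V D × V D)) λ H →
    Unique H × All (LM._∈ arcs D) H ×
    ((+ length H) ℤ.≤ (+ length (arcs D)) ℤ.- k) ×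
    (∀ u v d → IsDist (arcs D) u v d →
       ∃[ e ] (Walk H u v e × (ℕ→ℚ e ℚ.≤ fα d ℚ.* ℕ→ℚ d ℚ.+ fβ d)))

consec : {A : Set} → List A → List (A × A)
consec []           = []
consec (x ∷ [])     = []
consec (x ∷ y ∷ xs) = (x , y) ∷ consec (y ∷ xs)

-- Vertices for the case ⌊t⌋ ≥ 3: w, R_l[i], R_c[i], R_r[i], B[i],
-- and q subdivision vertices S[i][0..q-1] on the arc (R_c[i],R_r[i]).
data Vtx (n q : ℕ) : Set where
  w  : Vtx n q
  Rl Rc Rr B : Fin n → Vtx n q
  S  : Fin n → Fin q → Vtx n q

-- edges v_i v_j ∈ E(G) as ordered pairs (i , j) (each edge appears as
-- both (i , j) and (j , i))
edgePairs : (G : Graph) → List (Fin (n G) × Fin (n G))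
edgePairs G = concatMap (λ i → concatMap (λ j → sel i j (adj G i j)) (allFin (n G))) (allFin (n G))
  where
  sel : Fin (n G) → Fin (n G) → Bool → List (Fin (n G) × Fin (n G))
  sel i j true  = (i , j) ∷ []
  sel i j false = []

-- the digraph before the final step, with the arc (R_c[i],R_r[i])
-- subdivided q times (q = 0 : not subdivided)
DSub : (G : Graph) → (q : ℕ) → Digraph
DSub G q = record
  { V    = Vtx (n G) q
  ; arcs = concatMap perVertex (allFin (n G))
           ++ concatMap (λ { (i , j) → (Rr i , B j) ∷ [] }) (edgePairs G) }
  where
  perVertex : Fin (n G) → List (Vtx (n G) q × Vtx (n G) q)
  perVertex i = (w , Rl i) ∷ (w , Rc i) ∷ (w , B i) ∷ (Rl i , Rc i) ∷ (Rr i , B i)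
                ∷ consec (Rc i ∷ map (S i) (allFin q) ++ Rr i ∷ [])

-- Vertices for the case ⌊t⌋ = 2: R_c[i] and R_r[i] contracted into Z[i].
data VtxC (n : ℕ) : Set where
  w  : VtxC n
  Rl Z B : Fin n → VtxC n

DCon : (G : Graph) → Digraph
DCon G = record
  { V    = VtxC (n G)
  ; arcs = concatMap perVertex (allFin (n G))
           ++ concatMap (λ { (i , j) → (Z i , B j) ∷ [] }) (edgePairs G) }
  where
  perVertex : Fin (n G) → List (VtxC (n G) × VtxC (n G))
  perVertex i = (w , Rl i) ∷ (w , Z i) ∷ (w , B i) ∷ (Rl i , Z i) ∷ (Z i , B i) ∷ []

-- the construction, depending on s = ⌊t⌋ (s ≥ 2 under the hypotheses):
-- s = 2 : contract; s = 3 : nothing (q = 0); s ≥ 4 : subdivide ⌊t-3⌋ = s-3 times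
DRed : (G : Graph) → ℕ → Digraph
DRed G 0 = DCon G
DRed G 1 = DCon G
DRed G 2 = DCon G
DRed G (ℕ.suc (ℕ.suc (ℕ.suc m))) = DSub G m

-- ⌊t⌋ as a natural number (t ≥ 2 > 0 under the hypotheses)
floorℕ : ℚ → ℕ
floorℕ t = ℤ.∣ floor t ∣

Monotone : (ℕ → ℚ) → Set
Monotone f = ∀ a b → a ℕ.≤ b → f a ℚ.≤ f b

NonNeg : (ℕ → ℚ) → Set
NonNeg f = ∀ a → ℚ.0ℚ ℚ.≤ f a

-- Every arc other than the free arcs (w , R_c[i])
-- and (w , B[i]) is the only arc leaving its tail, the only arc entering its head, or leaves a vertex
-- whose out-arcs all end in sinks, so it must itself belong to H.  If (w , B[i]) ∉ H, the walk replacing it cannot go through R_l[j]: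
-- heights, which grow by at most one along an arc, show that this detour needs more than s arcs.  So it
-- starts with a free arc (w , R_c[j]) ∈ H, runs through the gadget of v_j and leaves it by an arc
-- (R_r[j] , B[i]) (both R_c[j] and R_r[j] are Z[j] after the contraction); thus v_j dominates v_i, and
-- the vertices keeping a free arc form a dominating set X.
-- Counting: H misses at least k = 2n − l free arcs, a vertex of X misses at most one of its two free
-- arcs and any other vertex misses both, so |X| ≤ 2n − k = l.
module Submission where

open import Defs hiding (sym)
open import Data.Nat using (ℕ; _*_)
open import Data.Integer as ℤ using (ℤ; +_; _-_)
open import Data.Rational as ℚ using (ℚ; 1ℚ; _+_; _≤_)
open import Data.Fin.Subset using (Subset; ∣_∣)
open import Data.Product using (_×_; ∃-syntax)

import Data.Nat as ℕ
open import Data.Nat using (zero; suc; z≤n; s≤s)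
import Data.Nat.Properties as ℕₚ
open import Data.Nat.DivMod using (_/_; m*n/n≡m; /-monoˡ-≤)
import Data.Nat.Coprimality as Coprime
import Data.Integer.Properties as ℤₚ
open import Data.Integer.DivMod using (div-pos-is-/ℕ)
open import Data.Integer.Tactic.RingSolver using (solve-∀)
import Data.Rational.Properties as ℚₚ
open import Algebra.Properties.CommutativeSemigroup ℕₚ.+-commutativeSemigroup using (interchange)
open import Data.Bool using (Bool; true; false; _∨_; if_then_else_)
open import Data.Bool.Properties using (∨-zeroʳ)
open import Data.Empty using (⊥-elim)
open import Data.Fin as Fin using (Fin; toℕ)
import Data.Fin.Properties as Finₚ
import Data.Fin.Subset as Subset
open import Data.Maybe using (Maybe; just; nothing)
import Data.Maybe.Properties as Maybeₚ
open import Data.Product using (∃; ∃₂; _,_; proj₁; proj₂)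
import Data.Product.Properties as Productₚ
open import Data.Sum using (_⊎_; inj₁; inj₂; [_,_]′)
import Data.Sum.Properties as Sumₚ
import Data.Vec as Vec
open import Data.Vec.Properties using (lookup∘tabulate; lookup⇒[]=)
open import Data.List using (List; []; _∷_; _++_; concat; concatMap; map; tabulate; allFin; length; filter)
open import Data.List.Properties using (filter-notAll; length-++; map-tabulate)
open import Data.List.Membership.Propositional using (_∈_; _∉_)
open import Data.List.Membership.Propositional.Properties
  using (∈-++⁺ˡ; ∈-++⁺ʳ; ∈-++⁻; ∈-map⁻; ∈-allFin; ∈-filter⁺; ∈-concat⁺′; ∈-tabulate⁺)
open import Data.List.Membership.Propositional.Properties.Core using (Any↔)
open import Data.List.Membership.Propositional.Properties.WithK using (unique⇒irrelevant)
open import Data.List.Relation.Unary.Any as Any using (here; there)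
open import Data.List.Relation.Unary.Any.Properties using (map↔; concat↔; there-injective)
open import Data.List.Relation.Unary.All as All using ([]; _∷_)
import Data.List.Relation.Unary.All.Properties as Allₚ
open import Data.List.Relation.Unary.AllPairs as AllPairs using ([]; _∷_)
import Data.List.Relation.Unary.AllPairs.Properties as AllPairsₚ
open import Data.List.Relation.Unary.Unique.Propositional using (Unique)
import Data.List.Relation.Unary.Unique.Propositional.Properties as Uniqueₚ
open import Data.List.Relation.Binary.Disjoint.Propositional using (Disjoint)
open import Data.List.Relation.Binary.Subset.Propositional using (_⊆_)
open import Function using (_∘_; id; _↔_; Inverse; Injection; mk↣)
open import Function.Properties.Inverse using (↔-trans; ↔-sym; ↔⇒↣)
open import Relation.Binary.Definitions using (DecidableEquality)
open import Relation.Binary.PropositionalEquality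
  using (_≡_; _≢_; refl; sym; trans; cong; cong₂; subst; subst₂)
open import Relation.Nullary using (¬_; Dec; yes; no; does; ¬?)
open import Relation.Nullary.Decidable using (dec-true; via-injection)

≡-dec-via-retraction : {A C : Set} (code : A → C) (decode : C → A) → (∀ a → decode (code a) ≡ a) →
                       DecidableEquality C → DecidableEquality A
≡-dec-via-retraction code decode retraction = via-injection (mk↣ code-injective)
  where
  code-injective : ∀ {a b} → code a ≡ code b → a ≡ b
  code-injective {a} {b} e = trans (sym (retraction a)) (trans (cong decode e) (retraction b))

module _ {A : Set} where

  irrelevant⇒Unique : {xs : List A} → (∀ {x} (p q : x ∈ xs) → p ≡ q) → Unique xs
  irrelevant⇒Unique {[]} _ = []
  irrelevant⇒Unique {x ∷ xs} irr =
    All.tabulate x∉xs ∷ irrelevant⇒Unique (λ p q → there-injective (irr (there p) (there q)))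
    where
    x∉xs : ∀ {y} → y ∈ xs → x ≢ y
    x∉xs y∈xs refl with irr (here refl) (there y∈xs)
    ... | ()

  Unique⇒length≤ : DecidableEquality A → {xs ys : List A} → Unique xs → xs ⊆ ys → length xs ℕ.≤ length ys
  Unique⇒length≤ _≟_ {[]} _ _ = z≤n
  Unique⇒length≤ _≟_ {x ∷ xs} {ys} (x∉xs ∷ xs!) xs⊆ys =
    ℕₚ.≤-trans (s≤s (Unique⇒length≤ _≟_ xs! xs⊆ys∖x))
               (filter-notAll (¬? ∘ (x ≟_)) ys (Any.map (λ x≡y x≢y → x≢y x≡y) (xs⊆ys (here refl))))
    where
    xs⊆ys∖x : xs ⊆ filter (¬? ∘ (x ≟_)) ys
    xs⊆ys∖x y∈xs = ∈-filter⁺ (¬? ∘ (x ≟_)) (xs⊆ys (there y∈xs)) (All.lookup x∉xs y∈xs)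

  Unique-concatMap : {B : Set} {f : A → List B} {xs : List A} → Unique xs → (∀ x → Unique (f x)) →
                     (∀ {x y} → x ≢ y → Disjoint (f x) (f y)) → Unique (concatMap f xs)
  Unique-concatMap xs! f! f-disjoint =
    Uniqueₚ.concat⁺ (Allₚ.map⁺ (All.universal f! _)) (AllPairsₚ.map⁺ (AllPairs.map f-disjoint xs!))

module _ {A B : Set} {f : A → List B} {xs : List A} {y : B} where

  ∈-concatMap↔ : (∃ λ x → x ∈ xs × y ∈ f x) ↔ y ∈ concatMap f xs
  ∈-concatMap↔ = ↔-trans Any↔ (↔-trans map↔ concat↔)

  ∈-concatMap⁺′ : ∀ {x} → x ∈ xs → y ∈ f x → y ∈ concatMap f xs
  ∈-concatMap⁺′ x∈xs y∈fx = Inverse.to ∈-concatMap↔ (_ , x∈xs , y∈fx)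

  ∈-concatMap⁻′ : y ∈ concatMap f xs → ∃ λ x → x ∈ xs × y ∈ f x
  ∈-concatMap⁻′ = Inverse.from ∈-concatMap↔

  ∈-concatMap⁻′-injective : ∀ {p q} → ∈-concatMap⁻′ p ≡ ∈-concatMap⁻′ q → p ≡ q
  ∈-concatMap⁻′-injective = Injection.injective (↔⇒↣ (↔-sym ∈-concatMap↔))

module _ {A : Set} where

  consec-source∈ : ∀ {xs : List A} {a b} → (a , b) ∈ consec xs → a ∈ xs
  consec-source∈ {x ∷ y ∷ xs} (here refl) = here refl
  consec-source∈ {x ∷ y ∷ xs} (there p) = there (consec-source∈ p)

  consec-source∈-init : ∀ (xs : List A) {z a b} → (a , b) ∈ consec (xs ++ z ∷ []) → a ∈ xs
  consec-source∈-init (x ∷ []) (here refl) = here refl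
  consec-source∈-init (x ∷ y ∷ xs) (here refl) = here refl
  consec-source∈-init (x ∷ y ∷ xs) (there p) = there (consec-source∈-init (y ∷ xs) p)

  consec-target∈ : ∀ {x : A} {xs a b} → (a , b) ∈ consec (x ∷ xs) → b ∈ xs
  consec-target∈ {xs = y ∷ xs} (here refl) = here refl
  consec-target∈ {xs = y ∷ xs} (there p) = there (consec-target∈ p)

  consec-functional : ∀ {xs : List A} {a b c} → Unique xs →
                      (a , b) ∈ consec xs → (a , c) ∈ consec xs → b ≡ c
  consec-functional {x ∷ y ∷ xs} _ (here refl) (here refl) = refl
  consec-functional {x ∷ y ∷ xs} (x∉ ∷ _) (here refl) (there p) =
    ⊥-elim (All.lookup x∉ (consec-source∈ p) refl)
  consec-functional {x ∷ y ∷ xs} (x∉ ∷ _) (there p) (here refl) =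
    ⊥-elim (All.lookup x∉ (consec-source∈ p) refl)
  consec-functional {x ∷ y ∷ xs} (_ ∷ xs!) (there p) (there q) = consec-functional xs! p q

  consec-unique : ∀ {xs : List A} → Unique xs → Unique (consec xs)
  consec-unique {[]} _ = []
  consec-unique {x ∷ []} _ = []
  consec-unique {x ∷ y ∷ xs} (x∉ ∷ xs!) =
    All.tabulate (λ p e → All.lookup x∉ (consec-source∈ p) (cong proj₁ e)) ∷ consec-unique xs!

  consec-path-height : (h : A → ℕ) {q : ℕ} {g : Fin q → A} {x y : A} {c : ℕ} →
                       h x ≡ c → (∀ k → h (g k) ≡ suc c ℕ.+ toℕ k) → h y ≡ suc c ℕ.+ q →
                       ∀ {a b} → (a , b) ∈ consec (x ∷ tabulate g ++ y ∷ []) → h b ≡ suc (h a)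
  consec-path-height h {zero} hx _ hy (here refl) =
    trans hy (trans (ℕₚ.+-identityʳ _) (cong suc (sym hx)))
  consec-path-height h {suc q} hx hg _ (here refl) =
    trans (hg Fin.zero) (trans (ℕₚ.+-identityʳ _) (cong suc (sym hx)))
  consec-path-height h {suc q} {c = c} _ hg hy (there p) =
    consec-path-height h (trans (hg Fin.zero) (ℕₚ.+-identityʳ _))
      (λ k → trans (hg (Fin.suc k)) (cong suc (ℕₚ.+-suc c (toℕ k))))
      (trans hy (cong suc (ℕₚ.+-suc c q))) p

-- The hypothesis of cellwise-Unique speaks about memberships of the whole list rather than about
-- each cell: the cells of edgePairs come from a function local to its definition, which cannot be named.
module _ {m : ℕ} {cell : Fin m → Fin m → List (Fin m × Fin m)} where

  OnlyOccurrence : ∀ {c} i → (∃ λ j → j ∈ allFin m × c ∈ cell i j) → Set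
  OnlyOccurrence {c} i (j , _ , c∈) = c ≡ (i , j) × (∀ c∈′ → c∈ ≡ c∈′)

  OnlyOccurrenceIn : ∀ {c} → c ∈ concatMap (λ i → concatMap (cell i) (allFin m)) (allFin m) → Set
  OnlyOccurrenceIn c∈ = let i , _ , c∈row = ∈-concatMap⁻′ {xs = allFin m} c∈ in
                        OnlyOccurrence i (∈-concatMap⁻′ {xs = allFin m} c∈row)

  cellwise-Unique : (∀ {c} (c∈ : c ∈ concatMap (λ i → concatMap (cell i) (allFin m)) (allFin m)) →
                       OnlyOccurrenceIn c∈) →
                    Unique (concatMap (λ i → concatMap (cell i) (allFin m)) (allFin m))
  cellwise-Unique only = irrelevant⇒Unique (λ p q → ∈-concatMap⁻′-injective (rows-≡ _ _ (only p) (only q)))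
    where
    cells-≡ : ∀ {c i} (s s′ : ∃ λ j → j ∈ allFin m × c ∈ cell i j) →
              OnlyOccurrence i s → OnlyOccurrence i s′ → s ≡ s′
    cells-≡ (j , j∈ , e) (j′ , j∈′ , e′) (refl , e-only) (refl , _)
      with e-only e′ | unique⇒irrelevant (Uniqueₚ.allFin⁺ m) j∈ j∈′
    ... | refl | refl = refl

    rows-≡ : ∀ {c} (t t′ : ∃ λ i → i ∈ allFin m × c ∈ concatMap (cell i) (allFin m)) →
             OnlyOccurrence (proj₁ t) (∈-concatMap⁻′ {xs = allFin m} (proj₂ (proj₂ t))) →
             OnlyOccurrence (proj₁ t′) (∈-concatMap⁻′ {xs = allFin m} (proj₂ (proj₂ t′))) → t ≡ t′
    rows-≡ (i , i∈ , r) (i′ , i∈′ , r′) only only′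
      with cong proj₁ (trans (sym (proj₁ only)) (proj₁ only′))
    ... | refl
      with unique⇒irrelevant (Uniqueₚ.allFin⁺ m) i∈ i∈′ | ∈-concatMap⁻′-injective (cells-≡ _ _ only only′)
    ... | refl | refl = refl

Dominates : (G : Graph) → Fin (n G) → Fin (n G) → Set
Dominates G j i = j ≡ i ⊎ adj G j i ≡ true

module _ (G : Graph) where

  adj⇒≢ : ∀ {i j} → adj G i j ≡ true → i ≢ j
  adj⇒≢ {i} e refl with trans (sym e) (irrfl G i)
  ... | ()

  ∈-edgePairs⁻ : ∀ {i j} → (i , j) ∈ edgePairs G → adj G i j ≡ true
  ∈-edgePairs⁻ p with ∈-concatMap⁻′ {xs = allFin (n G)} p
  ... | i , _ , row with ∈-concatMap⁻′ {xs = allFin (n G)} row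
  ... | j , _ , entry with adj G i j in e | entry
  ... | true | here refl = e
  ... | false | ()

  edgePairs-unique : Unique (edgePairs G)
  edgePairs-unique = cellwise-Unique only-occurrence
    where
    only-occurrence : ∀ {c} (c∈ : c ∈ edgePairs G) → OnlyOccurrenceIn {m = n G} c∈
    only-occurrence c∈ with ∈-concatMap⁻′ {xs = allFin (n G)} c∈
    ... | i , _ , row with ∈-concatMap⁻′ {xs = allFin (n G)} row
    ... | j , _ , entry with adj G i j | entry
    ... | true | here refl = refl , λ { (here refl) → refl }
    ... | false | ()

-- arcs (DCon G) and arcs (DSub G q) are definitionally gadgetArcs for the appropriate gadgets.
module GadgetArcs (G : Graph) {V : Set} (gadget : Fin (n G) → List (V × V)) (right bottom : Fin (n G) → V) where

  edgeArcs : List (V × V)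
  edgeArcs = concatMap (λ e → (right (proj₁ e) , bottom (proj₂ e)) ∷ []) (edgePairs G)

  gadgetArcs : List (V × V)
  gadgetArcs = concatMap gadget (allFin (n G)) ++ edgeArcs

  ∈-gadgetArcs⁺ : ∀ i {a} → a ∈ gadget i → a ∈ gadgetArcs
  ∈-gadgetArcs⁺ i a∈ = ∈-++⁺ˡ (∈-concatMap⁺′ (∈-allFin i) a∈)

  ∈-gadgetArcs⁻ : ∀ {a} → a ∈ gadgetArcs →
                  (∃ λ i → a ∈ gadget i) ⊎ (∃₂ λ i j → a ≡ (right i , bottom j) × adj G i j ≡ true)
  ∈-gadgetArcs⁻ a∈ with ∈-++⁻ (concatMap gadget (allFin (n G))) a∈
  ... | inj₁ a∈g with ∈-concatMap⁻′ {xs = allFin (n G)} a∈g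
  ...   | i , _ , a∈gi = inj₁ (i , a∈gi)
  ∈-gadgetArcs⁻ a∈ | inj₂ a∈e with ∈-concatMap⁻′ {xs = edgePairs G} a∈e
  ...   | (i , j) , ij∈ , here refl = inj₂ (i , j , refl , ∈-edgePairs⁻ G ij∈)

  gadgetArcs-unique :
    (∀ i → Unique (gadget i)) →
    (index : V → Maybe (Fin (n G))) → (∀ {i a} → a ∈ gadget i → index (proj₂ a) ≡ just i) →
    (∀ {i x y} → (right x , bottom y) ∈ gadget i → x ≡ y) →
    (∀ {x y x′ y′} → (right x , bottom y) ≡ (right x′ , bottom y′) → (x , y) ≡ (x′ , y′)) →
    Unique gadgetArcs
  gadgetArcs-unique gadget! index index-∈ diagonal edge-injective =
    Uniqueₚ.++⁺ (Unique-concatMap (Uniqueₚ.allFin⁺ _) gadget! gadgets-disjoint)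
                (Unique-concatMap (edgePairs-unique G) (λ _ → [] ∷ []) edges-disjoint)
                gadgets-edges-disjoint
    where
    gadgets-disjoint : ∀ {i j} → i ≢ j → Disjoint (gadget i) (gadget j)
    gadgets-disjoint i≢j (a∈i , a∈j) = i≢j (Maybeₚ.just-injective (trans (sym (index-∈ a∈i)) (index-∈ a∈j)))

    edges-disjoint : ∀ {e e′} → e ≢ e′ → Disjoint ((right (proj₁ e) , bottom (proj₂ e)) ∷ [])
                                                  ((right (proj₁ e′) , bottom (proj₂ e′)) ∷ [])
    edges-disjoint e≢e′ (here refl , here eq) = e≢e′ (edge-injective eq)

    gadgets-edges-disjoint : Disjoint (concatMap gadget (allFin (n G))) edgeArcs
    gadgets-edges-disjoint (a∈g , a∈e)
      with ∈-concatMap⁻′ {xs = allFin (n G)} a∈g | ∈-concatMap⁻′ {xs = edgePairs G} a∈e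
    ... | i , _ , a∈gi | (x , y) , xy∈ , here refl = adj⇒≢ G (∈-edgePairs⁻ G xy∈) (diagonal a∈gi)

budget-bound : ∀ {h a m c N : ℕ} (l : ℤ) →
               + h ℤ.≤ + a - (+ N - l) → a ℕ.≤ h ℕ.+ m → c ℕ.+ m ℕ.≤ N → + c ℤ.≤ l
budget-bound {h} {a} {m} {c} {N} l h≤ a≤ c+m≤ = begin
  + c                                                  ≡⟨ isolate (+ h) (+ a) (+ c) (+ m) ⟩
  + h ℤ.+ + a ℤ.+ (+ c ℤ.+ + m) - total                 ≤⟨ ℤₚ.+-monoˡ-≤ (ℤ.- total) sum-bound ⟩
  (+ a - (+ N - l)) ℤ.+ (+ h ℤ.+ + m) ℤ.+ + N - total  ≡⟨ cancel (+ h) (+ a) (+ m) (+ N) l ⟩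
  l                                                    ∎
  where
  open ℤₚ.≤-Reasoning

  total : ℤ
  total = + h ℤ.+ + a ℤ.+ + m

  a≤′ : + a ℤ.≤ + h ℤ.+ + m
  a≤′ = ℤₚ.≤-trans (ℤ.+≤+ a≤) (ℤₚ.≤-reflexive (ℤₚ.pos-+ h m))

  c+m≤′ : + c ℤ.+ + m ℤ.≤ + N
  c+m≤′ = ℤₚ.≤-trans (ℤₚ.≤-reflexive (sym (ℤₚ.pos-+ c m))) (ℤ.+≤+ c+m≤)

  sum-bound : + h ℤ.+ + a ℤ.+ (+ c ℤ.+ + m) ℤ.≤ (+ a - (+ N - l)) ℤ.+ (+ h ℤ.+ + m) ℤ.+ + N
  sum-bound = ℤₚ.+-mono-≤ (ℤₚ.+-mono-≤ h≤ a≤′) c+m≤′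

  isolate : ∀ h a c m → c ≡ h ℤ.+ a ℤ.+ (c ℤ.+ m) - (h ℤ.+ a ℤ.+ m)
  isolate = solve-∀

  cancel : ∀ h a m N l → (a - (N - l)) ℤ.+ (h ℤ.+ m) ℤ.+ N - (h ℤ.+ a ℤ.+ m) ≡ l
  cancel = solve-∀

∣∷∣ : ∀ {k} (b : Bool) (p : Subset k) → ∣ b Vec.∷ p ∣ ≡ (if b then 1 else 0) ℕ.+ ∣ p ∣
∣∷∣ true _ = refl
∣∷∣ false _ = refl

count-slots : {X : Set} {k : ℕ} (used : Fin k → Bool) (missing : Fin k → List X) →
              (∀ i → (if used i then 1 else 0) ℕ.+ length (missing i) ℕ.≤ 2) →
              ∣ Vec.tabulate used ∣ ℕ.+ length (concat (tabulate missing)) ℕ.≤ 2 * k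
count-slots {k = zero} _ _ _ = z≤n
count-slots {X} {suc k} used missing cost = begin
  ∣ Vec.tabulate used ∣ ℕ.+ length (missing₀ ++ rest)
    ≡⟨ cong₂ ℕ._+_ (∣∷∣ (used Fin.zero) later) (length-++ missing₀) ⟩
  (cost₀ ℕ.+ ∣ later ∣) ℕ.+ (length missing₀ ℕ.+ length rest)
    ≡⟨ interchange cost₀ ∣ later ∣ (length missing₀) (length rest) ⟩
  (cost₀ ℕ.+ length missing₀) ℕ.+ (∣ later ∣ ℕ.+ length rest)
    ≤⟨ ℕₚ.+-mono-≤ (cost Fin.zero) (count-slots (used ∘ Fin.suc) (missing ∘ Fin.suc) (cost ∘ Fin.suc)) ⟩
  2 ℕ.+ 2 * k
    ≡⟨ ℕₚ.*-suc 2 k ⟨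
  2 * suc k
    ∎
  where
  open ℕₚ.≤-Reasoning

  cost₀ : ℕ
  cost₀ = if used Fin.zero then 1 else 0

  missing₀ rest : List X
  missing₀ = missing Fin.zero
  rest = concat (tabulate (missing ∘ Fin.suc))

  later : Subset k
  later = Vec.tabulate (used ∘ Fin.suc)

module Counting {X : Set} (_≟_ : DecidableEquality X) (G : Graph) (H : List X) (enter exit : Fin (n G) → X) where
  open import Data.List.Membership.DecPropositional _≟_ using (_∈?_)

  lacking : (x : X) → Dec (x ∈ H) → List X
  lacking x (yes _) = []
  lacking x (no _) = x ∷ []

  ∈H⊎lacking : ∀ {x} (x∈? : Dec (x ∈ H)) → x ∈ H ⊎ x ∈ lacking x x∈?
  ∈H⊎lacking (yes x∈H) = inj₁ x∈H
  ∈H⊎lacking (no _) = inj₂ (here refl)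

  slot-cost : ∀ {x y} (x∈? : Dec (x ∈ H)) (y∈? : Dec (y ∈ H)) →
              (if does x∈? ∨ does y∈? then 1 else 0) ℕ.+ length (lacking x x∈? ++ lacking y y∈?) ℕ.≤ 2
  slot-cost (yes _) (yes _) = s≤s z≤n
  slot-cost (yes _) (no _) = s≤s (s≤s z≤n)
  slot-cost (no _) (yes _) = s≤s (s≤s z≤n)
  slot-cost (no _) (no _) = s≤s (s≤s z≤n)

  used : Fin (n G) → Bool
  used i = does (enter i ∈? H) ∨ does (exit i ∈? H)

  missing : Fin (n G) → List X
  missing i = lacking (enter i) (enter i ∈? H) ++ lacking (exit i) (exit i ∈? H)

  chosen : Subset (n G)
  chosen = Vec.tabulate used

  chosen-∋ : ∀ {i} → used i ≡ true → i Subset.∈ chosen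
  chosen-∋ {i} used-i = lookup⇒[]= i chosen (trans (lookup∘tabulate used i) used-i)

  enter-chosen : ∀ {i} → enter i ∈ H → i Subset.∈ chosen
  enter-chosen {i} enter∈H = chosen-∋ (cong (_∨ _) (dec-true (enter i ∈? H) enter∈H))

  exit-chosen : ∀ {i} → exit i ∈ H → i Subset.∈ chosen
  exit-chosen {i} exit∈H = chosen-∋ (trans (cong (_ ∨_) (dec-true (exit i ∈? H) exit∈H)) (∨-zeroʳ _))

  dominating-set : (A : List X) (l : ℤ) → Unique A →
                   (∀ {a} → a ∈ A → a ∈ H ⊎ (∃ λ i → a ≡ enter i) ⊎ (∃ λ i → a ≡ exit i)) →
                   (∀ i → exit i ∉ H → ∃ λ j → enter j ∈ H × Dominates G j i) →
                   + length H ℤ.≤ + length A - (+ (2 * n G) - l) →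
                   ∃[ X ] (IsDominating G X × + ∣ X ∣ ℤ.≤ l)
  dominating-set A l A! forced dominator size =
    chosen , chosen-dominating ,
    budget-bound l size |A|≤ (count-slots used missing (λ i → slot-cost (enter i ∈? H) (exit i ∈? H)))
    where
    chosen-dominating : IsDominating G chosen
    chosen-dominating v with exit v ∈? H
    ... | yes exit∈H = inj₁ (exit-chosen exit∈H)
    ... | no exit∉H with dominator v exit∉H
    ...   | j , enter∈H , inj₁ refl = inj₁ (enter-chosen enter∈H)
    ...   | j , enter∈H , inj₂ j~v = inj₂ (j , enter-chosen enter∈H , j~v)

    missing⊆ : ∀ i {x} → x ∈ missing i → x ∈ H ++ concat (tabulate missing)
    missing⊆ i x∈ = ∈-++⁺ʳ H (∈-concat⁺′ x∈ (∈-tabulate⁺ i))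

    A⊆H++missing : A ⊆ H ++ concat (tabulate missing)
    A⊆H++missing a∈A with forced a∈A
    ... | inj₁ a∈H = ∈-++⁺ˡ a∈H
    ... | inj₂ (inj₁ (i , refl)) = [ ∈-++⁺ˡ , missing⊆ i ∘ ∈-++⁺ˡ ]′ (∈H⊎lacking (enter i ∈? H))
    ... | inj₂ (inj₂ (i , refl)) = [ ∈-++⁺ˡ , missing⊆ i ∘ ∈-++⁺ʳ _ ]′ (∈H⊎lacking (exit i ∈? H))

    |A|≤ : length A ℕ.≤ length H ℕ.+ length (concat (tabulate missing))
    |A|≤ = ℕₚ.≤-trans (Unique⇒length≤ _≟_ A! A⊆H++missing) (ℕₚ.≤-reflexive (length-++ H))

module _ {V : Set} {A : List (V × V)} where

  Walk-preserves : (P : V → Set) → (∀ {x y} → (x , y) ∈ A → P x → P y) →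
                   ∀ {u v d} → Walk A u v d → P u → P v
  Walk-preserves P step [] Pu = Pu
  Walk-preserves P step (a ∷ rest) Pu = Walk-preserves P step rest (step a Pu)

  Walk-height : (h : V → ℕ) → (∀ {x y} → (x , y) ∈ A → h y ℕ.≤ suc (h x)) →
                ∀ {u v d} → Walk A u v d → h v ℕ.≤ h u ℕ.+ d
  Walk-height h step {v = v} [] = ℕₚ.≤-reflexive (sym (ℕₚ.+-identityʳ (h v)))
  Walk-height h step {u} {d = suc d} (a ∷ rest) = begin
    h _              ≤⟨ Walk-height h step rest ⟩
    h _ ℕ.+ d        ≤⟨ ℕₚ.+-monoˡ-≤ d (step a) ⟩
    suc (h u) ℕ.+ d  ≡⟨ ℕₚ.+-suc (h u) d ⟨
    h u ℕ.+ suc d    ∎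
    where open ℕₚ.≤-Reasoning

  last-arc : ∀ {u v d} → Walk A u v (suc d) → ∃ λ x → (x , v) ∈ A
  last-arc (a ∷ []) = _ , a
  last-arc (_ ∷ rest@(_ ∷ _)) = last-arc rest

  arc⇒IsDist : ∀ {u v} → (u , v) ∈ A → u ≢ v → IsDist A u v 1
  arc⇒IsDist uv∈A u≢v = uv∈A ∷ [] , λ { .0 (s≤s z≤n) [] → u≢v refl }

module Forced {V : Set} {A H : List (V × V)} (H⊆A : H ⊆ A)
              (connected : ∀ {u v} → (u , v) ∈ A → u ≢ v → ∃ λ d → Walk H u v d) where

  only-out-arc∈H : ∀ {u v} → (u , v) ∈ A → u ≢ v → (∀ {y} → (u , y) ∈ A → y ≡ v) → (u , v) ∈ H
  only-out-arc∈H uv∈A u≢v out with connected uv∈A u≢v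
  ... | _ , [] = ⊥-elim (u≢v refl)
  ... | _ , a ∷ _ = subst (λ y → (_ , y) ∈ H) (out (H⊆A a)) a

  only-in-arc∈H : ∀ {u v} → (u , v) ∈ A → u ≢ v → (∀ {x} → (x , v) ∈ A → x ≡ u) → (u , v) ∈ H
  only-in-arc∈H uv∈A u≢v into with connected uv∈A u≢v
  ... | _ , [] = ⊥-elim (u≢v refl)
  ... | _ , walk@(_ ∷ _) with last-arc walk
  ...   | _ , a = subst (λ x → (x , _) ∈ H) (into (H⊆A a)) a

  into-sinks∈H : ∀ {u v} → (u , v) ∈ A → u ≢ v → (∀ {y z} → (u , y) ∈ A → (y , z) ∉ A) →
                 (u , v) ∈ H
  into-sinks∈H uv∈A u≢v sinks with connected uv∈A u≢v
  ... | _ , [] = ⊥-elim (u≢v refl)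
  ... | _ , a ∷ [] = a
  ... | _ , a ∷ b ∷ _ = ⊥-elim (sinks (H⊆A a) (H⊆A b))

ℕ→ℚ≤mkℚ⇒ : ∀ {e N d} .{c : Coprime.Coprime ℤ.∣ N ∣ (suc d)} → ℕ→ℚ e ℚ.≤ ℚ.mkℚ N d c → + (e * suc d) ℤ.≤ N
ℕ→ℚ≤mkℚ⇒ {e} {N} {d} e≤t = subst₂ ℤ._≤_ (sym (ℤₚ.pos-* e (suc d))) (ℤₚ.*-identityʳ N)
  (ℚₚ.drop-*≤* (subst (ℚ._≤ _) (ℚₚ.normalize-coprime (Coprime.sym (Coprime.1-coprimeTo e))) e≤t))

≤⇒≤floorℕ : ∀ e t → ℕ→ℚ e ℚ.≤ t → e ℕ.≤ floorℕ t
≤⇒≤floorℕ e (ℚ.mkℚ N d _) e≤t with ℕ→ℚ≤mkℚ⇒ {e} e≤t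
... | ℤ.+≤+ {n = N′} e*d≤N′ = begin
  e                       ≡⟨ m*n/n≡m e (suc d) ⟨
  e * suc d / suc d       ≤⟨ /-monoˡ-≤ (suc d) e*d≤N′ ⟩
  N′ / suc d              ≡⟨ cong ℤ.∣_∣ (div-pos-is-/ℕ (+ N′) (suc d)) ⟨
  ℤ.∣ + N′ ℤ./ + suc d ∣  ∎
  where open ℕₚ.≤-Reasoning

record ArcSpanner (D : Digraph) (k : ℤ) (s : ℕ) : Set where
  field
    H       : List (V D × V D)
    H⊆A     : H ⊆ arcs D
    size    : + length H ℤ.≤ + length (arcs D) - k
    stretch : ∀ {u v} → (u , v) ∈ arcs D → u ≢ v → ∃ λ e → Walk H u v e × e ℕ.≤ s

  connected : ∀ {u v} → (u , v) ∈ arcs D → u ≢ v → ∃ λ d → Walk H u v d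
  connected uv∈A u≢v with stretch uv∈A u≢v
  ... | e , walk , _ = e , walk

DLSYes⇒ArcSpanner : ∀ {D} fα fβ {k} → DLSYes D fα fβ k → ArcSpanner D k (floorℕ (fα 1 ℚ.+ fβ 1))
DLSYes⇒ArcSpanner {D} fα fβ (_ , H , _ , H⊆A , size , spans) = record
  { H = H ; H⊆A = All.lookup H⊆A ; size = size ; stretch = stretch }
  where
  stretch : ∀ {u v} → (u , v) ∈ arcs D → u ≢ v →
            ∃ λ e → Walk H u v e × e ℕ.≤ floorℕ (fα 1 ℚ.+ fβ 1)
  stretch uv∈A u≢v with spans _ _ 1 (arc⇒IsDist uv∈A u≢v)
  ... | e , walk , e≤ =
    e , walk , ≤⇒≤floorℕ e _ (subst (λ x → ℕ→ℚ e ℚ.≤ x ℚ.+ fβ 1) (ℚₚ.*-identityʳ (fα 1)) e≤)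

-- The contracted digraph, used when ⌊t⌋ ≤ 2

module Contracted (G : Graph) where

  Vertex : Set
  Vertex = VtxC (n G)

  gadget : Fin (n G) → List (Vertex × Vertex)
  gadget i = (w , Rl i) ∷ (w , Z i) ∷ (w , B i) ∷ (Rl i , Z i) ∷ (Z i , B i) ∷ []

  open GadgetArcs G gadget Z B

  Code : Set
  Code = Maybe (Fin (n G) ⊎ Fin (n G) ⊎ Fin (n G))

  code : Vertex → Code
  code w = nothing
  code (Rl i) = just (inj₁ i)
  code (Z i) = just (inj₂ (inj₁ i))
  code (B i) = just (inj₂ (inj₂ i))

  decode : Code → Vertex
  decode nothing = w
  decode (just (inj₁ i)) = Rl i
  decode (just (inj₂ (inj₁ i))) = Z i
  decode (just (inj₂ (inj₂ i))) = B i

  decode∘code : ∀ v → decode (code v) ≡ v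
  decode∘code w = refl
  decode∘code (Rl _) = refl
  decode∘code (Z _) = refl
  decode∘code (B _) = refl

  _≟_ : DecidableEquality Vertex
  _≟_ = ≡-dec-via-retraction code decode decode∘code
          (Maybeₚ.≡-dec (Sumₚ.≡-dec Finₚ._≟_ (Sumₚ.≡-dec Finₚ._≟_ Finₚ._≟_)))

  data Arc : Vertex × Vertex → Set where
    w→Rl : ∀ i → Arc (w , Rl i)
    w→Z  : ∀ i → Arc (w , Z i)
    w→B  : ∀ i → Arc (w , B i)
    Rl→Z : ∀ i → Arc (Rl i , Z i)
    Z→B  : ∀ {i j} → Dominates G i j → Arc (Z i , B j)

  arc : ∀ {a} → a ∈ gadgetArcs → Arc a
  arc a∈ with ∈-gadgetArcs⁻ a∈
  ... | inj₁ (i , here refl) = w→Rl i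
  ... | inj₁ (i , there (here refl)) = w→Z i
  ... | inj₁ (i , there (there (here refl))) = w→B i
  ... | inj₁ (i , there (there (there (here refl)))) = Rl→Z i
  ... | inj₁ (i , there (there (there (there (here refl))))) = Z→B (inj₁ refl)
  ... | inj₂ (i , j , refl , i~j) = Z→B (inj₂ i~j)

  index : Vertex → Maybe (Fin (n G))
  index w = nothing
  index (Rl i) = just i
  index (Z i) = just i
  index (B i) = just i

  arcs-unique : Unique gadgetArcs
  arcs-unique = gadgetArcs-unique gadget-unique index target-index diagonal (λ { refl → refl })
    where
    gadget-unique : ∀ i → Unique (gadget i)
    gadget-unique i = ((λ ()) ∷ (λ ()) ∷ (λ ()) ∷ (λ ()) ∷ []) ∷ ((λ ()) ∷ (λ ()) ∷ (λ ()) ∷ [])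
                    ∷ ((λ ()) ∷ (λ ()) ∷ []) ∷ ((λ ()) ∷ []) ∷ [] ∷ []

    target-index : ∀ {i a} → a ∈ gadget i → index (proj₂ a) ≡ just i
    target-index (here refl) = refl
    target-index (there (here refl)) = refl
    target-index (there (there (here refl))) = refl
    target-index (there (there (there (here refl)))) = refl
    target-index (there (there (there (there (here refl))))) = refl

    diagonal : ∀ {i x y} → (Z x , B y) ∈ gadget i → x ≡ y
    diagonal (there (there (there (there (here refl))))) = refl

  into-Rl : ∀ {x i} → Arc (x , Rl i) → x ≡ w
  into-Rl (w→Rl _) = refl

  out-of-Rl : ∀ {i y} → Arc (Rl i , y) → y ≡ Z i
  out-of-Rl (Rl→Z _) = refl

  out-of-B : ∀ {i y} → ¬ Arc (B i , y)
  out-of-B ()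

  out-of-Z : ∀ {i y z} → Arc (Z i , y) → ¬ Arc (y , z)
  out-of-Z (Z→B _) = out-of-B

  height : Vertex → ℕ
  height w = 2
  height (Rl _) = 0
  height (Z _) = 1
  height (B _) = 2

  height-arc : ∀ {x y} → Arc (x , y) → height y ℕ.≤ suc (height x)
  height-arc (w→Rl _) = z≤n
  height-arc (w→Z _) = s≤s z≤n
  height-arc (w→B _) = s≤s (s≤s z≤n)
  height-arc (Rl→Z _) = ℕₚ.≤-refl
  height-arc (Z→B _) = ℕₚ.≤-refl

  module _ {s : ℕ} {k : ℤ} (spanner : ArcSpanner (DCon G) k s) where
    open ArcSpanner spanner
    open Forced H⊆A connected

    forced : ∀ {a} → a ∈ gadgetArcs → a ∈ H ⊎ (∃ λ i → a ≡ (w , Z i)) ⊎ (∃ λ i → a ≡ (w , B i))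
    forced a∈ with arc a∈
    ... | w→Rl i = inj₁ (only-in-arc∈H a∈ (λ ()) (into-Rl ∘ arc))
    ... | w→Z i = inj₂ (inj₁ (i , refl))
    ... | w→B i = inj₂ (inj₂ (i , refl))
    ... | Rl→Z i = inj₁ (only-out-arc∈H a∈ (λ ()) (out-of-Rl ∘ arc))
    ... | Z→B _ = inj₁ (into-sinks∈H a∈ (λ ()) (λ y∈ z∈ → out-of-Z (arc y∈) (arc z∈)))

    Z-walk : ∀ {i j d} → Walk H (Z j) (B i) d → Dominates G j i
    Z-walk (a ∷ rest) with arc (H⊆A a) | rest
    ... | Z→B j~i | [] = j~i
    ... | Z→B _ | b ∷ _ = ⊥-elim (out-of-B (arc (H⊆A b)))

    first-step : ∀ {i y d} → s ℕ.≤ 2 → (w , B i) ∉ H → Arc (w , y) → (w , y) ∈ H → Walk H y (B i) d →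
                 suc d ℕ.≤ s → ∃ λ j → (w , Z j) ∈ H × Dominates G j i
    first-step s≤2 _ (w→Rl j) _ rest d<s =
      ⊥-elim (ℕₚ.<⇒≱ (ℕₚ.≤-trans d<s s≤2) (Walk-height height (height-arc ∘ arc ∘ H⊆A) rest))
    first-step _ _ (w→Z j) w→Zj∈H rest _ = j , w→Zj∈H , Z-walk rest
    first-step _ w→Bi∉H (w→B j) w→Bj∈H [] _ = ⊥-elim (w→Bi∉H w→Bj∈H)
    first-step _ _ (w→B j) _ (b ∷ _) _ = ⊥-elim (out-of-B (arc (H⊆A b)))

    dominator : s ℕ.≤ 2 → ∀ i → (w , B i) ∉ H → ∃ λ j → (w , Z j) ∈ H × Dominates G j i
    dominator s≤2 i w→Bi∉H with stretch (∈-gadgetArcs⁺ i (there (there (here refl)))) (λ ())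
    ... | _ , a ∷ rest , d<s = first-step s≤2 w→Bi∉H (arc (H⊆A a)) a rest d<s

  dominating : ∀ {s} → s ℕ.≤ 2 → (l : ℤ) → ArcSpanner (DCon G) (+ (2 * n G) - l) s →
               ∃[ X ] (IsDominating G X × + ∣ X ∣ ℤ.≤ l)
  dominating s≤2 l spanner =
    Counting.dominating-set (Productₚ.≡-dec _≟_ _≟_) G H (λ i → w , Z i) (λ i → w , B i)
      gadgetArcs l arcs-unique (forced spanner) (dominator spanner s≤2) size
    where open ArcSpanner spanner

-- The subdivided digraph, used when ⌊t⌋ = 3 + q

module Subdivided (G : Graph) (q : ℕ) where

  Vertex : Set
  Vertex = Vtx (n G) q

  path : Fin (n G) → List Vertex
  path i = Rc i ∷ map (S i) (allFin q) ++ Rr i ∷ []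

  gadget : Fin (n G) → List (Vertex × Vertex)
  gadget i = (w , Rl i) ∷ (w , Rc i) ∷ (w , B i) ∷ (Rl i , Rc i) ∷ (Rr i , B i) ∷ consec (path i)

  open GadgetArcs G gadget Rr B

  Code : Set
  Code = Maybe (Fin (n G) ⊎ Fin (n G) ⊎ Fin (n G) ⊎ Fin (n G) ⊎ Fin (n G) × Fin q)

  code : Vertex → Code
  code w = nothing
  code (Rl i) = just (inj₁ i)
  code (Rc i) = just (inj₂ (inj₁ i))
  code (Rr i) = just (inj₂ (inj₂ (inj₁ i)))
  code (B i) = just (inj₂ (inj₂ (inj₂ (inj₁ i))))
  code (S i k) = just (inj₂ (inj₂ (inj₂ (inj₂ (i , k)))))

  decode : Code → Vertex
  decode nothing = w
  decode (just (inj₁ i)) = Rl i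
  decode (just (inj₂ (inj₁ i))) = Rc i
  decode (just (inj₂ (inj₂ (inj₁ i)))) = Rr i
  decode (just (inj₂ (inj₂ (inj₂ (inj₁ i))))) = B i
  decode (just (inj₂ (inj₂ (inj₂ (inj₂ (i , k)))))) = S i k

  decode∘code : ∀ v → decode (code v) ≡ v
  decode∘code w = refl
  decode∘code (Rl _) = refl
  decode∘code (Rc _) = refl
  decode∘code (Rr _) = refl
  decode∘code (B _) = refl
  decode∘code (S _ _) = refl

  _≟_ : DecidableEquality Vertex
  _≟_ = ≡-dec-via-retraction code decode decode∘code
          (Maybeₚ.≡-dec (Sumₚ.≡-dec Finₚ._≟_ (Sumₚ.≡-dec Finₚ._≟_ (Sumₚ.≡-dec Finₚ._≟_
            (Sumₚ.≡-dec Finₚ._≟_ (Productₚ.≡-dec Finₚ._≟_ Finₚ._≟_))))))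

  data OnPath (i : Fin (n G)) : Vertex → Set where
    start : OnPath i (Rc i)
    inner : ∀ k → OnPath i (S i k)
    end   : OnPath i (Rr i)

  path-unique : ∀ i → Unique (path i)
  path-unique i =
    All.tabulate Rc∉ ∷ Uniqueₚ.++⁺ (Uniqueₚ.map⁺ S-injective (Uniqueₚ.allFin⁺ q)) ([] ∷ []) S∌Rr
    where
    Rc∉ : ∀ {v} → v ∈ map (S i) (allFin q) ++ Rr i ∷ [] → Rc i ≢ v
    Rc∉ v∈ refl with ∈-++⁻ (map (S i) (allFin q)) v∈
    ... | inj₁ v∈S with ∈-map⁻ (S i) v∈S
    ...   | _ , _ , ()
    Rc∉ v∈ refl | inj₂ (here ())

    S-injective : ∀ {k k′} → S i k ≡ S i k′ → k ≡ k′
    S-injective refl = refl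

    S∌Rr : Disjoint (map (S i) (allFin q)) (Rr i ∷ [])
    S∌Rr (v∈S , here refl) with ∈-map⁻ (S i) v∈S
    ... | _ , _ , ()

  path-source : ∀ {i u v} → (u , v) ∈ consec (path i) → OnPath i u × u ≢ Rr i
  path-source {i} p with consec-source∈-init (Rc i ∷ map (S i) (allFin q)) p
  ... | here refl = start , (λ ())
  ... | there u∈S with ∈-map⁻ (S i) u∈S
  ...   | k , _ , refl = inner k , (λ ())

  path-target : ∀ {i u v} → (u , v) ∈ consec (path i) → OnPath i v
  path-target {i} p with ∈-++⁻ (map (S i) (allFin q)) (consec-target∈ p)
  ... | inj₁ v∈S with ∈-map⁻ (S i) v∈S
  ...   | k , _ , refl = inner k
  path-target p | inj₂ (here refl) = end

  height : Vertex → ℕ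
  height w = 3 ℕ.+ q
  height (Rl _) = 0
  height (Rc _) = 1
  height (S _ k) = 2 ℕ.+ toℕ k
  height (Rr _) = 2 ℕ.+ q
  height (B _) = 3 ℕ.+ q

  path-height : ∀ {i u v} → (u , v) ∈ consec (path i) → height v ≡ suc (height u)
  path-height {i} p = consec-path-height height refl (λ _ → refl) refl
                        (subst (λ vs → _ ∈ consec (Rc i ∷ vs ++ Rr i ∷ [])) (map-tabulate id (S i)) p)

  path-loopless : ∀ {i u v} → (u , v) ∈ consec (path i) → u ≢ v
  path-loopless p refl = ℕₚ.1+n≢n (sym (path-height p))

  data Arc : Vertex × Vertex → Set where
    w→Rl  : ∀ i → Arc (w , Rl i)
    w→Rc  : ∀ i → Arc (w , Rc i)
    w→B   : ∀ i → Arc (w , B i)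
    Rl→Rc : ∀ i → Arc (Rl i , Rc i)
    Rr→B  : ∀ {i j} → Dominates G i j → Arc (Rr i , B j)
    Rc→   : ∀ i {v} → (Rc i , v) ∈ consec (path i) → Arc (Rc i , v)
    S→    : ∀ i k {v} → (S i k , v) ∈ consec (path i) → Arc (S i k , v)

  path-arc : ∀ i {a} → a ∈ consec (path i) → Arc a
  path-arc i {u , v} p with path-source p
  ... | start , _ = Rc→ i p
  ... | inner k , _ = S→ i k p
  ... | end , u≢Rr = ⊥-elim (u≢Rr refl)

  arc : ∀ {a} → a ∈ gadgetArcs → Arc a
  arc a∈ with ∈-gadgetArcs⁻ a∈
  ... | inj₁ (i , here refl) = w→Rl i
  ... | inj₁ (i , there (here refl)) = w→Rc i
  ... | inj₁ (i , there (there (here refl))) = w→B i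
  ... | inj₁ (i , there (there (there (here refl)))) = Rl→Rc i
  ... | inj₁ (i , there (there (there (there (here refl))))) = Rr→B (inj₁ refl)
  ... | inj₁ (i , there (there (there (there (there p))))) = path-arc i p
  ... | inj₂ (i , j , refl , i~j) = Rr→B (inj₂ i~j)

  index : Vertex → Maybe (Fin (n G))
  index w = nothing
  index (Rl i) = just i
  index (Rc i) = just i
  index (Rr i) = just i
  index (B i) = just i
  index (S i _) = just i

  arcs-unique : Unique gadgetArcs
  arcs-unique = gadgetArcs-unique gadget-unique index target-index diagonal (λ { refl → refl })
    where
    off-path : ∀ {i u v} → ¬ OnPath i u → All.All ((u , v) ≢_) (consec (path i))
    off-path u∉ = All.tabulate (λ { p refl → u∉ (proj₁ (path-source p)) })

    gadget-unique : ∀ i → Unique (gadget i)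
    gadget-unique i = ((λ ()) ∷ (λ ()) ∷ (λ ()) ∷ (λ ()) ∷ off-path (λ ()))
                    ∷ ((λ ()) ∷ (λ ()) ∷ (λ ()) ∷ off-path (λ ()))
                    ∷ ((λ ()) ∷ (λ ()) ∷ off-path (λ ()))
                    ∷ ((λ ()) ∷ off-path (λ ()))
                    ∷ All.tabulate (λ { p refl → proj₂ (path-source p) refl })
                    ∷ consec-unique (path-unique i)

    target-index : ∀ {i a} → a ∈ gadget i → index (proj₂ a) ≡ just i
    target-index (here refl) = refl
    target-index (there (here refl)) = refl
    target-index (there (there (here refl))) = refl
    target-index (there (there (there (here refl)))) = refl
    target-index (there (there (there (there (here refl))))) = refl
    target-index (there (there (there (there (there p))))) with path-target p
    ... | start = refl
    ... | inner _ = refl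
    ... | end = refl

    diagonal : ∀ {i x y} → (Rr x , B y) ∈ gadget i → x ≡ y
    diagonal (there (there (there (there (here refl))))) = refl
    diagonal (there (there (there (there (there p))))) with path-source p
    ... | end , Rr≢Rr = ⊥-elim (Rr≢Rr refl)

  into-Rl : ∀ {x i} → Arc (x , Rl i) → x ≡ w
  into-Rl (w→Rl _) = refl
  into-Rl (Rc→ _ p) with path-target p
  ... | ()
  into-Rl (S→ _ _ p) with path-target p
  ... | ()

  out-of-Rl : ∀ {i y} → Arc (Rl i , y) → y ≡ Rc i
  out-of-Rl (Rl→Rc _) = refl

  out-of-B : ∀ {i y} → ¬ Arc (B i , y)
  out-of-B ()

  out-of-Rr : ∀ {i y z} → Arc (Rr i , y) → ¬ Arc (y , z)
  out-of-Rr (Rr→B _) = out-of-B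

  out-of-Rc : ∀ {i v y} → (Rc i , v) ∈ consec (path i) → Arc (Rc i , y) → y ≡ v
  out-of-Rc {i} p (Rc→ _ p′) = consec-functional (path-unique i) p′ p

  out-of-S : ∀ {i k v y} → (S i k , v) ∈ consec (path i) → Arc (S i k , y) → y ≡ v
  out-of-S {i} p (S→ _ _ p′) = consec-functional (path-unique i) p′ p

  height-arc : ∀ {x y} → Arc (x , y) → height y ℕ.≤ suc (height x)
  height-arc (w→Rl _) = z≤n
  height-arc (w→Rc _) = s≤s z≤n
  height-arc (w→B _) = ℕₚ.n≤1+n _
  height-arc (Rl→Rc _) = ℕₚ.≤-refl
  height-arc (Rr→B _) = ℕₚ.≤-refl
  height-arc (Rc→ _ p) = ℕₚ.≤-reflexive (path-height p)
  height-arc (S→ _ _ p) = ℕₚ.≤-reflexive (path-height p)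

  data Downstream (j : Fin (n G)) : Vertex → Set where
    on-path : ∀ {v} → OnPath j v → Downstream j v
    exit    : ∀ {i} → Dominates G j i → Downstream j (B i)

  downstream-arc : ∀ {j u v} → Arc (u , v) → Downstream j u → Downstream j v
  downstream-arc a (exit _) = ⊥-elim (out-of-B a)
  downstream-arc (Rc→ _ p) (on-path start) = on-path (path-target p)
  downstream-arc (S→ _ _ p) (on-path (inner _)) = on-path (path-target p)
  downstream-arc (Rr→B j~i) (on-path end) = exit j~i

  module _ {k : ℤ} (spanner : ArcSpanner (DSub G q) k (3 ℕ.+ q)) where
    open ArcSpanner spanner
    open Forced H⊆A connected

    forced : ∀ {a} → a ∈ gadgetArcs → a ∈ H ⊎ (∃ λ i → a ≡ (w , Rc i)) ⊎ (∃ λ i → a ≡ (w , B i))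
    forced a∈ with arc a∈
    ... | w→Rl i = inj₁ (only-in-arc∈H a∈ (λ ()) (into-Rl ∘ arc))
    ... | w→Rc i = inj₂ (inj₁ (i , refl))
    ... | w→B i = inj₂ (inj₂ (i , refl))
    ... | Rl→Rc i = inj₁ (only-out-arc∈H a∈ (λ ()) (out-of-Rl ∘ arc))
    ... | Rr→B _ = inj₁ (into-sinks∈H a∈ (λ ()) (λ y∈ z∈ → out-of-Rr (arc y∈) (arc z∈)))
    ... | Rc→ i p = inj₁ (only-out-arc∈H a∈ (path-loopless p) (out-of-Rc p ∘ arc))
    ... | S→ i k p = inj₁ (only-out-arc∈H a∈ (path-loopless p) (out-of-S p ∘ arc))

    first-step : ∀ {i y d} → (w , B i) ∉ H → Arc (w , y) → (w , y) ∈ H → Walk H y (B i) d →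
                 suc d ℕ.≤ 3 ℕ.+ q → ∃ λ j → (w , Rc j) ∈ H × Dominates G j i
    first-step _ (w→Rl j) _ rest d<s =
      ⊥-elim (ℕₚ.<⇒≱ d<s (Walk-height height (height-arc ∘ arc ∘ H⊆A) rest))
    first-step _ (w→Rc j) w→Rcj∈H rest _ =
      j , w→Rcj∈H , leaves (Walk-preserves (Downstream j) (downstream-arc ∘ arc ∘ H⊆A) rest (on-path start))
      where
      leaves : ∀ {i} → Downstream j (B i) → Dominates G j i
      leaves (exit j~i) = j~i
    first-step w→Bi∉H (w→B j) w→Bj∈H [] _ = ⊥-elim (w→Bi∉H w→Bj∈H)
    first-step _ (w→B j) _ (b ∷ _) _ = ⊥-elim (out-of-B (arc (H⊆A b)))

    dominator : ∀ i → (w , B i) ∉ H → ∃ λ j → (w , Rc j) ∈ H × Dominates G j i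
    dominator i w→Bi∉H with stretch (∈-gadgetArcs⁺ i (there (there (here refl)))) (λ ())
    ... | _ , a ∷ rest , d<s = first-step w→Bi∉H (arc (H⊆A a)) a rest d<s

  dominating : (l : ℤ) → ArcSpanner (DSub G q) (+ (2 * n G) - l) (3 ℕ.+ q) →
               ∃[ X ] (IsDominating G X × + ∣ X ∣ ℤ.≤ l)
  dominating l spanner =
    Counting.dominating-set (Productₚ.≡-dec _≟_ _≟_) G H (λ i → w , Rc i) (λ i → w , B i)
      gadgetArcs l arcs-unique (forced spanner) (dominator spanner) size
    where open ArcSpanner spanner

lemma2 : (fα fβ : ℕ → ℚ) → NonNeg fα → NonNeg fβ → Monotone fα → Monotone fβ →
         1ℚ ≤ fα 1 → ℕ→ℚ 2 ≤ fα 1 + fβ 1 →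
         (G : Graph) → (l : ℤ) →
         DLSYes (DRed G (floorℕ (fα 1 + fβ 1))) fα fβ (+ (2 * n G) - l) →
         ∃[ X ] (IsDominating G X × (+ ∣ X ∣) ℤ.≤ l)
lemma2 fα fβ _ _ _ _ _ _ G l yes-instance =
  dominating (floorℕ (fα 1 + fβ 1)) (DLSYes⇒ArcSpanner fα fβ yes-instance)
  where
  dominating : ∀ s → ArcSpanner (DRed G s) (+ (2 * n G) - l) s →
               ∃[ X ] (IsDominating G X × (+ ∣ X ∣) ℤ.≤ l)
  dominating 0 = Contracted.dominating G z≤n l
  dominating 1 = Contracted.dominating G (s≤s z≤n) l
  dominating 2 = Contracted.dominating G (s≤s (s≤s z≤n)) l
  dominating (suc (suc (suc q))) = Subdivided.dominating G q l
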